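{- Let $n\ge 3$ and $k$ be positive integers with $n\ge k+\lceil n/3\rceil$. For the cycle graph $C_n$, $$Sb_k(C_n)=\begin{cases}\left\lfloor\frac{3k+1}{2}\right\rfloor+1, & n\equiv 1\pmod 3,\\[2pt] \left\lceil\frac{3k-1}{2}\right\rceil+1, & n\equiv 2\pmod 3,\\[2pt] \left\lfloor\frac{3k-1}{2}\right\rfloor+1, & n\equiv 0\pmod 3.\end{cases}$$
   Context: $\gamma(G)$ is the domination number of $G$ (minimum size of a dominating set); $\gamma(C_n)=\lceil n/3\rceil$. For a positive integer $k$, $Sb_k(G)$ is the minimum size of a set $\mathcal{E}$ of edges of $G$ such that $\gamma(G-\mathcal{E})=\gamma(G)+k$. -}

module Defs where

open import Data.Nat using (ℕ; zero; suc; _+_; _*_; _∸_; _≤_; _/_)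
open import Data.Fin using (Fin; toℕ)
open import Data.Fin.Subset using (Subset; _∈_; _∉_; ∣_∣)
open import Data.Product using (Σ; _×_; ∃; ∃-syntax)
open import Data.Sum using (_⊎_)
open import Relation.Binary.PropositionalEquality using (_≡_)

Graph : ℕ → Set₁
Graph n = Fin n → Fin n → Set

IsDominating : ∀ {n} → Graph n → Subset n → Set
IsDominating {n} G D = (v : Fin n) → v ∈ D ⊎ (∃[ u ] (u ∈ D × G u v))

IsDominationNumber : ∀ {n} → Graph n → ℕ → Set
IsDominationNumber {n} G m =
  (∃[ D ] (IsDominating G D × ∣ D ∣ ≡ m)) ×
  ((D : Subset n) → IsDominating G D → m ≤ ∣ D ∣)

-- The cycle C_n on vertices 0,…,n-1 has n edges; edge i (i : Fin n)
-- joins vertex i and vertex i+1 (mod n).  Edge i has ends u, v (ordered):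
EdgeEnds : (n : ℕ) → Fin n → Fin n → Fin n → Set
EdgeEnds n i u v =
  toℕ u ≡ toℕ i ×
  (toℕ v ≡ suc (toℕ i) ⊎ (suc (toℕ i) ≡ n × toℕ v ≡ 0))

CycleMinus : (n : ℕ) → Subset n → Graph n
CycleMinus n E u v =
  ∃[ i ] (i ∉ E × (EdgeEnds n i u v ⊎ EdgeEnds n i v u))

noEdges : (n : ℕ) → Subset n
noEdges n = Data.Fin.Subset.⊥

Cycle : (n : ℕ) → Graph n
Cycle n = CycleMinus n (noEdges n)

Raises : (n k : ℕ) → Subset n → Set
Raises n k E =
  ∃[ m ] (IsDominationNumber (Cycle n) m × IsDominationNumber (CycleMinus n E) (m + k))

IsSb : (n k s : ℕ) → Set
IsSb n k s =
  (∃[ E ] (Raises n k E × ∣ E ∣ ≡ s)) ×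
  ((E : Subset n) → Raises n k E → s ≤ ∣ E ∣)

{-# OPTIONS --safe #-}

-- A vertex dominates at most 1 + (its degree) vertices. Hence n ≤ 3 γ(C_n), and deleting s
-- consecutive edges, which leaves a path on n − s + 1 vertices and s − 1 isolated vertices,
-- gives n + 2 s − 2 ≤ 3 γ. Conversely, once some edge is deleted C_n − E is a union of |E|
-- paths, and every third vertex of each path (plus its last vertex when needed) dominates,
-- so 3 γ(C_n − E) ≤ n + 2 |E|. Thus γ(C_n − E) ≤ ⌊(n + 2|E|)/3⌋ with equality for consecutive
-- edges, and Sb_k(C_n) is the least s with 3 (⌈n/3⌉ + k) ≤ n + 2 s; the three formulas are
-- this number for the three residues of n.

module Submission where

open import Defs
open import Data.Bool.Base using (Bool; true; false; not)
open import Data.Empty using (⊥-elim)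
open import Data.Fin.Base using (Fin; toℕ; fromℕ<) renaming (zero to fzero; suc to fsuc)
open import Data.Fin.Properties using (toℕ<n; toℕ-fromℕ<)
open import Data.Fin.Subset using (Subset; _∈_; _∉_; ∣_∣; ⊥; ⊤; ⁅_⁆; Nonempty)
open import Data.Fin.Subset.Properties using (∉⊥; ∣⊤∣≡n; x∈⁅x⁆; ∣⁅x⁆∣≡1; nonempty?; Empty-unique)
open import Data.Nat.Base
open import Data.Nat.Properties
open import Data.Nat.DivMod using (m≡m%n+[m/n]*n; m%n<n; %-distribˡ-+; m*n/n≡m; /-monoˡ-≤; m<n*o⇒m/o<n)
open import Data.Nat.Tactic.RingSolver using (solve-∀)
open import Data.Product using (_×_; _,_; proj₁; proj₂; ∃-syntax)
open import Data.Sum using (_⊎_; inj₁; inj₂)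
open import Data.Vec.Base using ([]; _∷_; _++_; here; there)
open import Function.Base using (_∘_)
open import Relation.Nullary using (yes; no)
open import Relation.Binary.PropositionalEquality

∑ : ℕ → (ℕ → ℕ) → ℕ
∑ zero    f = 0
∑ (suc n) f = ∑ n f + f n

syntax ∑ n (λ j → e) = ∑[ j < n ] e

∑-shift : ∀ n f → ∑ (suc n) f ≡ f 0 + ∑ n (f ∘ suc)
∑-shift zero    f = +-comm 0 (f 0)
∑-shift (suc n) f = begin
  ∑ (suc n) f + f (suc n)           ≡⟨ cong (_+ f (suc n)) (∑-shift n f) ⟩
  f 0 + ∑ n (f ∘ suc) + f (suc n)   ≡⟨ +-assoc (f 0) _ _ ⟩
  f 0 + ∑ (suc n) (f ∘ suc)         ∎
  where open ≡-Reasoning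

∑-cong : ∀ n {f g} → (∀ j → j < n → f j ≡ g j) → ∑ n f ≡ ∑ n g
∑-cong zero    eq = refl
∑-cong (suc n) eq = cong₂ _+_ (∑-cong n (λ j j<n → eq j (m<n⇒m<1+n j<n))) (eq n ≤-refl)

∑-mono-≤ : ∀ n {f g} → (∀ j → j < n → f j ≤ g j) → ∑ n f ≤ ∑ n g
∑-mono-≤ zero    le = z≤n
∑-mono-≤ (suc n) le = +-mono-≤ (∑-mono-≤ n (λ j j<n → le j (m<n⇒m<1+n j<n))) (le n ≤-refl)

∑-+ : ∀ n f g → ∑[ j < n ] (f j + g j) ≡ ∑ n f + ∑ n g
∑-+ zero    f g = refl
∑-+ (suc n) f g = begin
  ∑[ j < n ] (f j + g j) + (f n + g n)   ≡⟨ cong (_+ (f n + g n)) (∑-+ n f g) ⟩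
  ∑ n f + ∑ n g + (f n + g n)             ≡⟨ +-interchange (∑ n f) (∑ n g) (f n) (g n) ⟩
  ∑ n f + f n + (∑ n g + g n)             ∎
  where
  open ≡-Reasoning
  +-interchange : ∀ a b c d → a + b + (c + d) ≡ a + c + (b + d)
  +-interchange = solve-∀

∑-* : ∀ n c f → ∑[ j < n ] (c * f j) ≡ c * ∑ n f
∑-* zero    c f = sym (*-zeroʳ c)
∑-* (suc n) c f = trans (cong (_+ c * f n) (∑-* n c f)) (sym (*-distribˡ-+ c (∑ n f) (f n)))

∑-const : ∀ n c → ∑[ _ < n ] c ≡ n * c
∑-const zero    c = refl
∑-const (suc n) c = trans (cong (_+ c) (∑-const n c)) (+-comm (n * c) c)

∑-split : ∀ m n f → ∑ (m + n) f ≡ ∑ m f + ∑[ j < n ] f (m + j)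
∑-split m zero    f = trans (cong (λ x → ∑ x f) (+-identityʳ m)) (sym (+-identityʳ _))
∑-split m (suc n) f = begin
  ∑ (m + suc n) f                                 ≡⟨ cong (λ x → ∑ x f) (+-suc m n) ⟩
  ∑ (m + n) f + f (m + n)                         ≡⟨ cong (_+ f (m + n)) (∑-split m n f) ⟩
  ∑ m f + ∑[ j < n ] f (m + j) + f (m + n)        ≡⟨ +-assoc (∑ m f) _ _ ⟩
  ∑ m f + ∑[ j < suc n ] f (m + j)                ∎
  where open ≡-Reasoning

boolToℕ : Bool → ℕ
boolToℕ false = 0
boolToℕ true  = 1

boolToℕ≤1 : ∀ b → boolToℕ b ≤ 1
boolToℕ≤1 false = z≤n
boolToℕ≤1 true  = ≤-refl

boolToℕ≥1 : ∀ {b} → 1 ≤ boolToℕ b → b ≡ true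
boolToℕ≥1 {true} _ = refl

infixl 9 _!_

_!_ : ∀ {n} → Subset n → ℕ → Bool
[]      ! _     = false
(b ∷ p) ! zero  = b
(b ∷ p) ! suc j = p ! j

∈⇒! : ∀ {n} {v : Fin n} {p : Subset n} → v ∈ p → p ! toℕ v ≡ true
∈⇒! here      = refl
∈⇒! (there v∈p) = ∈⇒! v∈p

!⇒∈ : ∀ {n} (v : Fin n) (p : Subset n) → p ! toℕ v ≡ true → v ∈ p
!⇒∈ fzero    (true ∷ p) _  = here
!⇒∈ (fsuc v) (_ ∷ p)    eq = there (!⇒∈ v p eq)

∉⇒! : ∀ {n} (v : Fin n) (p : Subset n) → v ∉ p → p ! toℕ v ≡ false
∉⇒! v p v∉p with p ! toℕ v in eq
... | true  = ⊥-elim (v∉p (!⇒∈ v p eq))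
... | false = refl

!⇒∉ : ∀ {n} {v : Fin n} {p : Subset n} → p ! toℕ v ≡ false → v ∉ p
!⇒∉ eq v∈p with () ← trans (sym (∈⇒! v∈p)) eq

⊥! : ∀ n j → ⊥ {n} ! j ≡ false
⊥! zero    j       = refl
⊥! (suc n) zero    = refl
⊥! (suc n) (suc j) = ⊥! n j

fromBits : ∀ n → (ℕ → Bool) → Subset n
fromBits zero    g = []
fromBits (suc n) g = g 0 ∷ fromBits n (g ∘ suc)

fromBits-! : ∀ n g {j} → j < n → fromBits n g ! j ≡ g j
fromBits-! (suc n) g {zero}  _         = refl
fromBits-! (suc n) g {suc j} (s≤s j<n) = fromBits-! n (g ∘ suc) j<n

χ : ∀ {n} → Subset n → ℕ → ℕ
χ p j = boolToℕ (p ! j)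

∣p∣≡∑χ : ∀ {n} (p : Subset n) → ∣ p ∣ ≡ ∑ n (χ p)
∣p∣≡∑χ []              = refl
∣p∣≡∑χ {suc n} (b ∷ p) = begin
  ∣ b ∷ p ∣                 ≡⟨ head+tail b ⟩
  boolToℕ b + ∣ p ∣         ≡⟨ cong (boolToℕ b +_) (∣p∣≡∑χ p) ⟩
  boolToℕ b + ∑ n (χ p)     ≡⟨ ∑-shift n (χ (b ∷ p)) ⟨
  ∑ (suc n) (χ (b ∷ p))     ∎
  where
  open ≡-Reasoning
  head+tail : ∀ b → ∣ b ∷ p ∣ ≡ boolToℕ b + ∣ p ∣
  head+tail false = refl
  head+tail true  = refl

next : ℕ → ℕ → ℕ
next n j with suc j <? n
... | yes _ = suc j
... | no  _ = 0

prev : ℕ → ℕ → ℕ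
prev n zero    = pred n
prev n (suc j) = j

next-view : ∀ n j → (suc j < n × next n j ≡ suc j) ⊎ (n ≤ suc j × next n j ≡ 0)
next-view n j with suc j <? n
... | yes 1+j<n = inj₁ (1+j<n , refl)
... | no  1+j≮n = inj₂ (≮⇒≥ 1+j≮n , refl)

next-suc : ∀ {n j} → suc j < n → next n j ≡ suc j
next-suc {n} {j} 1+j<n with next-view n j
... | inj₁ (_ , eq)      = eq
... | inj₂ (n≤1+j , _)   = ⊥-elim (<⇒≱ 1+j<n n≤1+j)

next-last : ∀ m → next (suc m) m ≡ 0
next-last m with next-view (suc m) m
... | inj₁ (1+m<1+m , _) = ⊥-elim (<-irrefl refl 1+m<1+m)
... | inj₂ (_ , eq)      = eq

next<n : ∀ {n j} → j < n → next n j < n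
next<n {n} {j} j<n with next-view n j
... | inj₁ (1+j<n , eq) = subst (_< n) (sym eq) 1+j<n
... | inj₂ (_ , eq)     = subst (_< n) (sym eq) (≤-trans (s≤s z≤n) j<n)

prev<n : ∀ {n j} → j < n → prev n j < n
prev<n {suc n} {zero}  _   = ≤-refl
prev<n {n}     {suc j} j<n = <-trans (n<1+n j) j<n

prev-next : ∀ {n j} → j < n → prev n (next n j) ≡ j
prev-next {n} {j} j<n with next-view n j
... | inj₁ (_ , eq)     = cong (prev n) eq
... | inj₂ (n≤1+j , eq) = trans (cong (prev n) eq) (cong pred (≤-antisym n≤1+j j<n))

next-prev : ∀ {n j} → j < n → next n (prev n j) ≡ j
next-prev {suc n} {zero}  _   = next-last n
next-prev {n}     {suc j} j<n = next-suc j<n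

∑-next : ∀ n f → ∑[ j < n ] f (next n j) ≡ ∑ n f
∑-next zero    f = refl
∑-next (suc n) f = begin
  ∑[ j < n ] f (next (suc n) j) + f (next (suc n) n)
    ≡⟨ cong₂ _+_ (∑-cong n (λ j j<n → cong f (next-suc (s≤s j<n)))) (cong f (next-last n)) ⟩
  ∑ n (f ∘ suc) + f 0   ≡⟨ +-comm _ (f 0) ⟩
  f 0 + ∑ n (f ∘ suc)   ≡⟨ ∑-shift n f ⟨
  ∑ (suc n) f           ∎
  where open ≡-Reasoning

∑-prev : ∀ n f → ∑[ j < n ] f (prev n j) ≡ ∑ n f
∑-prev n f = begin
  ∑[ j < n ] f (prev n j)              ≡⟨ ∑-next n (f ∘ prev n) ⟨
  ∑[ j < n ] f (prev n (next n j))     ≡⟨ ∑-cong n (λ j j<n → cong f (prev-next j<n)) ⟩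
  ∑ n f                                ∎
  where open ≡-Reasoning

∑-+₃ : ∀ n f g h → ∑[ j < n ] (f j + g j + h j) ≡ ∑ n f + ∑ n g + ∑ n h
∑-+₃ n f g h = trans (∑-+ n (λ j → f j + g j) h) (cong (_+ ∑ n h) (∑-+ n f g))

edgeEnds⇒next : ∀ {n} {i u v : Fin n} → EdgeEnds n i u v → toℕ u ≡ toℕ i × toℕ v ≡ next n (toℕ i)
edgeEnds⇒next {n} {i} {u} {v} (u≡i , inj₁ v≡1+i) =
  u≡i , trans v≡1+i (sym (next-suc (subst (_< n) v≡1+i (toℕ<n v))))
edgeEnds⇒next {n} {i} (u≡i , inj₂ (1+i≡n , v≡0)) =
  u≡i , trans v≡0 (sym (subst (λ n → next n (toℕ i) ≡ 0) 1+i≡n (next-last (toℕ i))))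

next⇒edgeEnds : ∀ {n} (i v : Fin n) → toℕ v ≡ next n (toℕ i) → EdgeEnds n i i v
next⇒edgeEnds {n} i v v≡next with next-view n (toℕ i)
... | inj₁ (_ , eq)     = refl , inj₁ (trans v≡next eq)
... | inj₂ (n≤1+i , eq) = refl , inj₂ (≤-antisym (toℕ<n i) n≤1+i , trans v≡next eq)

data Adjacent {n} (E : Subset n) (a b : ℕ) : Set where
  forward  : b ≡ next n a → E ! a ≡ false → Adjacent E a b
  backward : a ≡ next n b → E ! b ≡ false → Adjacent E a b

CycleMinus⇒Adjacent : ∀ {n} (E : Subset n) {u v : Fin n} → CycleMinus n E u v → Adjacent E (toℕ u) (toℕ v)
CycleMinus⇒Adjacent {n} E (i , i∉E , inj₁ ends) with edgeEnds⇒next ends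
... | u≡i , v≡next = forward (trans v≡next (cong (next n) (sym u≡i))) (trans (cong (E !_) u≡i) (∉⇒! i E i∉E))
CycleMinus⇒Adjacent {n} E (i , i∉E , inj₂ ends) with edgeEnds⇒next ends
... | v≡i , u≡next = backward (trans u≡next (cong (next n) (sym v≡i))) (trans (cong (E !_) v≡i) (∉⇒! i E i∉E))

Adjacent⇒CycleMinus : ∀ {n} {E : Subset n} {u v : Fin n} → Adjacent E (toℕ u) (toℕ v) → CycleMinus n E u v
Adjacent⇒CycleMinus {u = u} {v} (forward v≡next uncut)  = u , !⇒∉ uncut , inj₁ (next⇒edgeEnds u v v≡next)
Adjacent⇒CycleMinus {u = u} {v} (backward u≡next uncut) = v , !⇒∉ uncut , inj₂ (next⇒edgeEnds v u u≡next)

dominated-at : ∀ {n} {E D : Subset n} → IsDominating (CycleMinus n E) D → ∀ {j} → j < n →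
  D ! j ≡ true ⊎ ∃[ a ] (a < n × D ! a ≡ true × Adjacent E a j)
dominated-at {E = E} {D} dom {j} j<n with dom (fromℕ< j<n)
... | inj₁ j∈D = inj₁ (subst (λ x → D ! x ≡ true) (toℕ-fromℕ< j<n) (∈⇒! j∈D))
... | inj₂ (u , u∈D , adj) =
  inj₂ (toℕ u , toℕ<n u , ∈⇒! u∈D , subst (Adjacent E (toℕ u)) (toℕ-fromℕ< j<n) (CycleMinus⇒Adjacent E adj))

adjacent-dominator : ∀ {n} {E D : Subset n} {a} {v : Fin n} → a < n → D ! a ≡ true → Adjacent E a (toℕ v) →
  ∃[ u ] (u ∈ D × CycleMinus n E u v)
adjacent-dominator {D = D} a<n a∈D adj =
  fromℕ< a<n ,
  !⇒∈ _ D (trans (cong (D !_) (toℕ-fromℕ< a<n)) a∈D) ,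
  Adjacent⇒CycleMinus (subst (λ x → Adjacent _ x _) (sym (toℕ-fromℕ< a<n)) adj)

uncut : ∀ {n} → Subset n → ℕ → ℕ
uncut E j = boolToℕ (not (E ! j))

degree : ∀ {n} → Subset n → ℕ → ℕ
degree {n} E j = uncut E j + uncut E (prev n j)

meets-closed-neighbourhood : ∀ {n} {E D : Subset n} → IsDominating (CycleMinus n E) D → ∀ {j} → j < n →
  1 ≤ uncut E (prev n j) * χ D (prev n j) + χ D j + uncut E j * χ D (next n j)
meets-closed-neighbourhood {n} {E} {D} dom {j} j<n with dominated-at dom j<n
... | inj₁ j∈D rewrite j∈D =
  ≤-trans (m≤n+m 1 (uncut E (prev n j) * χ D (prev n j))) (m≤m+n _ (uncut E j * χ D (next n j)))
... | inj₂ (a , a<n , a∈D , forward j≡next a-uncut)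
  rewrite trans (cong (prev n) j≡next) (prev-next a<n) | a-uncut | a∈D = s≤s z≤n
... | inj₂ (a , _ , a∈D , backward a≡next j-uncut)
  rewrite sym a≡next | j-uncut | a∈D = m≤n+m 1 _

domination-count : ∀ {n} (E D : Subset n) → IsDominating (CycleMinus n E) D →
  n ≤ ∑[ j < n ] (χ D j * suc (degree E j))
domination-count {n} E D dom = begin
  n                                       ≡⟨ trans (sym (*-identityʳ n)) (sym (∑-const n 1)) ⟩
  ∑[ _ < n ] 1                            ≤⟨ ∑-mono-≤ n (λ _ j<n → meets-closed-neighbourhood dom j<n) ⟩
  ∑[ j < n ] (before (prev n j) + χ D j + uncut E j * χ D (next n j))
    ≡⟨ ∑-+₃ n _ _ _ ⟩
  ∑[ j < n ] before (prev n j) + ∑ n (χ D) + ∑[ j < n ] (uncut E j * χ D (next n j))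
    ≡⟨ cong₂ (λ x y → x + ∑ n (χ D) + y) (∑-prev n before) after-rotated ⟩
  ∑ n before + ∑ n (χ D) + ∑ n after      ≡⟨ ∑-+₃ n _ _ _ ⟨
  ∑[ j < n ] (before j + χ D j + after j) ≡⟨ ∑-cong n (λ j _ → collect (uncut E j) (χ D j) _) ⟩
  ∑[ j < n ] (χ D j * suc (degree E j))   ∎
  where
  open ≤-Reasoning
  before after : ℕ → ℕ
  before j = uncut E j * χ D j
  after  j = uncut E (prev n j) * χ D j
  after-rotated : ∑[ j < n ] (uncut E j * χ D (next n j)) ≡ ∑ n after
  after-rotated = trans (∑-cong n (λ j j<n → cong (λ i → uncut E i * χ D (next n j)) (sym (prev-next j<n))))
                        (∑-next n after)
  collect : ∀ u d u′ → u * d + d + u′ * d ≡ d * suc (u + u′)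
  collect = solve-∀

degree≤2 : ∀ {n} (E : Subset n) j → degree E j ≤ 2
degree≤2 {n} E j = +-mono-≤ (boolToℕ≤1 (not (E ! j))) (boolToℕ≤1 (not (E ! prev n j)))

degree-⊥ : ∀ n j → degree (⊥ {n}) j ≡ 2
degree-⊥ n j rewrite ⊥! n j | ⊥! n (prev n j) = refl

cycle-lower-bound : ∀ {n} (D : Subset n) → IsDominating (Cycle n) D → n ≤ 3 * ∣ D ∣
cycle-lower-bound {n} D dom = begin
  n                                            ≤⟨ domination-count ⊥ D dom ⟩
  ∑[ j < n ] (χ D j * suc (degree (⊥ {n}) j))
    ≡⟨ ∑-cong n (λ j _ → trans (cong (λ d → χ D j * suc d) (degree-⊥ n j)) (*-comm (χ D j) 3)) ⟩
  ∑[ j < n ] (3 * χ D j)                       ≡⟨ ∑-* n 3 (χ D) ⟩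
  3 * ∑ n (χ D)                                ≡⟨ cong (3 *_) (∣p∣≡∑χ D) ⟨
  3 * ∣ D ∣                                    ∎
  where open ≤-Reasoning

-- C_n − block t s is the path 0 … t together with the isolated vertices t + 1, …, t + s − 1.
block : ∀ t s → Subset (t + s)
block t s = ⊥ {t} ++ ⊤ {s}

∣block∣ : ∀ t s → ∣ block t s ∣ ≡ s
∣block∣ zero    s = ∣⊤∣≡n s
∣block∣ (suc t) s = ∣block∣ t s

block-! : ∀ t s {j} → t ≤ j → j < t + s → block t s ! j ≡ true
block-! zero    (suc s) {zero}  _         _          = refl
block-! zero    (suc s) {suc j} _         (s≤s j<s)  = block-! zero s z≤n j<s
block-! (suc t) s       {suc j} (s≤s t≤j) (s≤s j<n)  = block-! t s t≤j j<n

block-nonempty : ∀ t s → Nonempty (block t (suc s))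
block-nonempty t s = fromℕ< t<n , !⇒∈ (fromℕ< t<n) (block t (suc s)) t-cut
  where
  t<n : t < t + suc s
  t<n = m<m+n t (s≤s z≤n)
  t-cut : block t (suc s) ! toℕ (fromℕ< t<n) ≡ true
  t-cut = trans (cong (block t (suc s) !_) (toℕ-fromℕ< t<n)) (block-! t (suc s) ≤-refl t<n)

block-lower-bound : ∀ t s (D : Subset (t + suc s)) →
  IsDominating (CycleMinus (t + suc s) (block t (suc s))) D → t + suc s + 2 * s ≤ 3 * ∣ D ∣
block-lower-bound t s D dom = begin
  n + 2 * s                                      ≤⟨ +-monoˡ-≤ (2 * s) (domination-count E D dom) ⟩
  ∑ n w + 2 * s                                  ≡⟨ cong (λ m → ∑ m w + 2 * s) (+-suc t s) ⟩
  ∑ (suc t + s) w + 2 * s                        ≡⟨ cong (_+ 2 * s) (∑-split (suc t) s w) ⟩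
  ∑ (suc t) w + ∑[ i < s ] w (suc t + i) + 2 * s ≡⟨ +-assoc (∑ (suc t) w) _ _ ⟩
  ∑ (suc t) w + (∑[ i < s ] w (suc t + i) + 2 * s)
    ≡⟨ cong (λ x → ∑ (suc t) w + (∑[ i < s ] w (suc t + i) + x)) (trans (*-comm 2 s) (sym (∑-const s 2))) ⟩
  ∑ (suc t) w + (∑[ i < s ] w (suc t + i) + ∑[ _ < s ] 2)
    ≡⟨ cong (∑ (suc t) w +_) (∑-+ s (λ i → w (suc t + i)) (λ _ → 2)) ⟨
  ∑ (suc t) w + ∑[ i < s ] (w (suc t + i) + 2)
    ≤⟨ +-mono-≤ (∑-mono-≤ (suc t) (λ j _ → path-vertex j)) (∑-mono-≤ s (λ i i<s → isolated-vertex i<s)) ⟩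
  ∑ (suc t) three-χ + ∑[ i < s ] three-χ (suc t + i) ≡⟨ ∑-split (suc t) s three-χ ⟨
  ∑ (suc t + s) three-χ                          ≡⟨ cong (λ m → ∑ m three-χ) (+-suc t s) ⟨
  ∑ n three-χ                                    ≡⟨ ∑-* n 3 (χ D) ⟩
  3 * ∑ n (χ D)                                  ≡⟨ cong (3 *_) (∣p∣≡∑χ D) ⟨
  3 * ∣ D ∣                                      ∎
  where
  open ≤-Reasoning
  n = t + suc s
  E = block t (suc s)
  w three-χ : ℕ → ℕ
  w j = χ D j * suc (degree E j)
  three-χ j = 3 * χ D j
  path-vertex : ∀ j → w j ≤ three-χ j
  path-vertex j = ≤-trans (*-monoʳ-≤ (χ D j) (s≤s (degree≤2 E j))) (≤-reflexive (*-comm (χ D j) 3))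
  isolated-vertex : ∀ {i} → i < s → w (suc t + i) + 2 ≤ three-χ (suc t + i)
  isolated-vertex {i} i<s = saturated isolated-degree isolated-in-D
    where
    saturated : ∀ {deg b} → deg ≡ 0 → b ≡ true → boolToℕ b * suc deg + 2 ≤ 3 * boolToℕ b
    saturated refl refl = ≤-refl
    j<n : suc (t + i) < n
    j<n = ≤-trans (s≤s (+-monoʳ-< t i<s)) (≤-reflexive (sym (+-suc t s)))
    uncut-before : uncut E (t + i) ≡ 0
    uncut-before = cong (boolToℕ ∘ not) (block-! t (suc s) (m≤m+n t i) (<-trans (n<1+n _) j<n))
    uncut-after : uncut E (suc (t + i)) ≡ 0
    uncut-after = cong (boolToℕ ∘ not) (block-! t (suc s) (m≤n⇒m≤1+n (m≤m+n t i)) j<n)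
    isolated-degree : degree E (suc (t + i)) ≡ 0
    isolated-degree = cong₂ _+_ uncut-after uncut-before
    isolated-in-D : D ! suc (t + i) ≡ true
    isolated-in-D = boolToℕ≥1 (only-middle uncut-before uncut-after (meets-closed-neighbourhood dom j<n))
      where
      only-middle : ∀ {u u′ a d b} → u ≡ 0 → u′ ≡ 0 → 1 ≤ u * a + d + u′ * b → 1 ≤ d
      only-middle refl refl 1≤d+0 = subst (1 ≤_) (+-identityʳ _) 1≤d+0

-- Walking around the cycle, each vertex is chosen, covered (dominated by its chosen
-- predecessor) or fresh, and a cut edge resets the phase to fresh. The potential turns
-- 3 |D| ≤ n + 2 |E| into the per-vertex inequality amortised.
data Phase : Set where
  fresh chosen covered : Phase

advance : Phase → Bool → Phase
advance _       true  = fresh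
advance fresh   false = chosen
advance chosen  false = covered
advance covered false = fresh

picks : Phase → Bool → Bool
picks fresh   cut = cut
picks chosen  _   = true
picks covered _   = false

potential : Phase → ℕ
potential fresh   = 1
potential chosen  = 2
potential covered = 0

amortised : ∀ p cut →
  3 * boolToℕ (picks p cut) + potential (advance p cut) ≤ 1 + 2 * boolToℕ cut + potential p
amortised fresh   true  = ≤ᵇ⇒≤ _ _ _
amortised fresh   false = ≤ᵇ⇒≤ _ _ _
amortised chosen  true  = ≤ᵇ⇒≤ _ _ _
amortised chosen  false = ≤ᵇ⇒≤ _ _ _
amortised covered true  = ≤ᵇ⇒≤ _ _ _
amortised covered false = ≤ᵇ⇒≤ _ _ _

not-picked : ∀ {p cut} → picks p cut ≡ false → (p ≡ fresh × cut ≡ false) ⊎ p ≡ covered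
not-picked {fresh}   refl = inj₁ (refl , refl)
not-picked {covered} _    = inj₂ refl

advance≡covered : ∀ {p cut} → advance p cut ≡ covered → p ≡ chosen × cut ≡ false
advance≡covered {chosen} {false} _ = refl , refl

run : (ℕ → Bool) → Phase → ℕ → Phase
run cut p zero    = p
run cut p (suc j) = advance (run cut p j) (cut j)

run-sync : ∀ cut {c} p q j → cut c ≡ true → c < j → run cut p j ≡ run cut q j
run-sync cut p q (suc j) cut-c c<1+j with m≤n⇒m<n∨m≡n (≤-pred c<1+j)
... | inj₁ c<j  = cong (λ r → advance r (cut j)) (run-sync cut p q j cut-c c<j)
... | inj₂ refl rewrite cut-c = refl

upper-bound : ∀ {n} (E : Subset n) → Nonempty E →
  ∃[ D ] (IsDominating (CycleMinus n E) D × 3 * ∣ D ∣ ≤ n + 2 * ∣ E ∣)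
upper-bound {n} E (i , i∈E) = D , dominating , bound
  where
  -- Starting in the phase reached after one lap makes the phases n-periodic, since the cut i
  -- synchronises every run.
  phase : ℕ → Phase
  phase = run (E !_) (run (E !_) fresh n)

  periodic : phase n ≡ phase 0
  periodic = run-sync (E !_) _ fresh n (∈⇒! i∈E) (toℕ<n i)

  phase-next : ∀ {j} → j < n → phase (next n j) ≡ advance (phase j) (E ! j)
  phase-next {j} j<n with next-view n j
  ... | inj₁ (_ , eq)     = cong phase eq
  ... | inj₂ (n≤1+j , eq) =
    trans (cong phase eq) (trans (sym periodic) (cong phase (sym (≤-antisym j<n n≤1+j))))

  D : Subset n
  D = fromBits n (λ j → picks (phase j) (E ! j))

  D-! : ∀ {j} → j < n → D ! j ≡ picks (phase j) (E ! j)
  D-! = fromBits-! n _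

  dominating : IsDominating (CycleMinus n E) D
  dominating v with picks (phase (toℕ v)) (E ! toℕ v) in picked
  ... | true  = inj₁ (!⇒∈ v D (trans (D-! (toℕ<n v)) picked))
  ... | false with not-picked picked
  ...   | inj₁ (fresh-v , uncut-v) =
    inj₂ (adjacent-dominator (next<n j<n) successor-chosen (backward refl uncut-v))
    where
    j<n = toℕ<n v
    successor-chosen : D ! next n (toℕ v) ≡ true
    successor-chosen = trans (D-! (next<n j<n))
      (cong (λ p → picks p (E ! next n (toℕ v))) (trans (phase-next j<n) (cong₂ advance fresh-v uncut-v)))
  ...   | inj₂ covered-v =
    inj₂ (adjacent-dominator (prev<n j<n) (trans (D-! (prev<n j<n)) (cong (λ p → picks p (E ! a)) chosen-a))
            (forward (sym (next-prev j<n)) uncut-a))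
    where
    j<n = toℕ<n v
    a = prev n (toℕ v)
    covered-after-a : advance (phase a) (E ! a) ≡ covered
    covered-after-a = trans (sym (phase-next (prev<n j<n))) (trans (cong phase (next-prev j<n)) covered-v)
    chosen-a = proj₁ (advance≡covered covered-after-a)
    uncut-a  = proj₂ (advance≡covered covered-after-a)

  ψ : ℕ → ℕ
  ψ = potential ∘ phase

  step : ∀ {j} → j < n → 3 * χ D j + ψ (next n j) ≤ 1 + 2 * χ E j + ψ j
  step {j} j<n = subst₂ (λ d p → 3 * boolToℕ d + potential p ≤ 1 + 2 * χ E j + ψ j)
    (sym (D-! j<n)) (sym (phase-next j<n)) (amortised (phase j) (E ! j))

  bound : 3 * ∣ D ∣ ≤ n + 2 * ∣ E ∣
  bound = +-cancelʳ-≤ (∑ n ψ) _ _ (begin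
    3 * ∣ D ∣ + ∑ n ψ
      ≡⟨ cong₂ _+_ (trans (cong (3 *_) (∣p∣≡∑χ D)) (sym (∑-* n 3 (χ D)))) (sym (∑-next n ψ)) ⟩
    ∑[ j < n ] (3 * χ D j) + ∑[ j < n ] ψ (next n j)     ≡⟨ ∑-+ n _ _ ⟨
    ∑[ j < n ] (3 * χ D j + ψ (next n j))                ≤⟨ ∑-mono-≤ n (λ _ → step) ⟩
    ∑[ j < n ] (1 + 2 * χ E j + ψ j)                     ≡⟨ ∑-+₃ n _ _ _ ⟩
    ∑[ _ < n ] 1 + ∑[ j < n ] (2 * χ E j) + ∑ n ψ
      ≡⟨ cong₂ (λ x y → x + y + ∑ n ψ) (trans (∑-const n 1) (*-identityʳ n))
                                        (trans (∑-* n 2 (χ E)) (cong (2 *_) (sym (∣p∣≡∑χ E)))) ⟩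
    n + 2 * ∣ E ∣ + ∑ n ψ                                ∎)
    where open ≤-Reasoning

3*a≤x⇒a≤x/3 : ∀ {a x} → 3 * a ≤ x → a ≤ x / 3
3*a≤x⇒a≤x/3 {a} {x} 3a≤x = subst (_≤ x / 3) (m*n/n≡m a 3) (/-monoˡ-≤ 3 (subst (_≤ x) (*-comm 3 a) 3a≤x))

x≤3*a+2⇒x/3≤a : ∀ {a x} → x ≤ 3 * a + 2 → x / 3 ≤ a
x≤3*a+2⇒x/3≤a {a} {x} x≤ = ≤-pred (m<n*o⇒m/o<n (≤-trans (s≤s x≤) (≤-reflexive (3a+3≡[1+a]*3 a))))
  where
  3a+3≡[1+a]*3 : ∀ a → suc (3 * a + 2) ≡ suc a * 3
  3a+3≡[1+a]*3 = solve-∀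

x/3≡a : ∀ {a x} → 3 * a ≤ x → x ≤ 3 * a + 2 → x / 3 ≡ a
x/3≡a 3a≤x x≤ = ≤-antisym (x≤3*a+2⇒x/3≤a x≤) (3*a≤x⇒a≤x/3 3a≤x)

2*a≤2*b+1⇒a≤b : ∀ {a b} → 2 * a ≤ 2 * b + 1 → a ≤ b
2*a≤2*b+1⇒a≤b {a} {b} le = ≤-pred (*-cancelˡ-< 2 a (suc b) (≤-trans (s≤s le) (≤-reflexive (2b+2≡2[1+b] b))))
  where
  2b+2≡2[1+b] : ∀ b → suc (2 * b + 1) ≡ 2 * suc b
  2b+2≡2[1+b] = solve-∀

domination-number-unique : ∀ {n} {G : Graph n} {m m′} →
  IsDominationNumber G m → IsDominationNumber G m′ → m ≡ m′
domination-number-unique ((D , dom , refl) , min) ((D′ , dom′ , refl) , min′) =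
  ≤-antisym (min D′ dom′) (min′ D dom)

domination-number-/3 : ∀ {n} {G : Graph n} {D x} → IsDominating G D → 3 * ∣ D ∣ ≤ x →
  (∀ D′ → IsDominating G D′ → x ≤ 3 * ∣ D′ ∣ + 2) → IsDominationNumber G (x / 3)
domination-number-/3 {G = G} {D} {x} dom 3∣D∣≤x lower =
  (D , dom , ≤-antisym (3*a≤x⇒a≤x/3 3∣D∣≤x) (x/3≤ D dom)) , x/3≤
  where
  x/3≤ : ∀ D′ → IsDominating G D′ → x / 3 ≤ ∣ D′ ∣
  x/3≤ D′ dom′ = x≤3*a+2⇒x/3≤a (lower D′ dom′)

dominating-cycle : ∀ {n} {E D : Subset n} → IsDominating (CycleMinus n E) D → IsDominating (Cycle n) D
dominating-cycle dom v with dom v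
... | inj₁ v∈D                        = inj₁ v∈D
... | inj₂ (u , u∈D , i , _ , ends)   = inj₂ (u , u∈D , i , ∉⊥ , ends)

γ-cycle : ∀ {n} → 0 < n → IsDominationNumber (Cycle n) ((n + 2) / 3)
γ-cycle {suc m} _ with upper-bound ⁅ fzero ⁆ (fzero , x∈⁅x⁆ fzero)
... | D , dom , bound =
  domination-number-/3 (dominating-cycle dom)
    (subst (λ e → 3 * ∣ D ∣ ≤ suc m + 2 * e) (∣⁅x⁆∣≡1 {suc m} fzero) bound)
    (λ D′ dom′ → +-monoˡ-≤ 2 (cycle-lower-bound D′ dom′))

γ-block : ∀ t s →
  IsDominationNumber (CycleMinus (t + suc s) (block t (suc s))) ((t + suc s + 2 * suc s) / 3)
γ-block t s with upper-bound (block t (suc s)) (block-nonempty t s)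
... | D , dom , bound =
  domination-number-/3 dom
    (subst (λ e → 3 * ∣ D ∣ ≤ t + suc s + 2 * e) (∣block∣ t (suc s)) bound)
    (λ D′ dom′ → ≤-trans (≤-reflexive (2[1+s]≡2s+2 (t + suc s) s)) (+-monoˡ-≤ 2 (block-lower-bound t s D′ dom′)))
  where
  2[1+s]≡2s+2 : ∀ n s → n + 2 * suc s ≡ n + 2 * s + 2
  2[1+s]≡2s+2 = solve-∀

Sb-block : ∀ t s k → 1 ≤ k →
  3 * ((t + suc s + 2) / 3 + k) ≤ t + suc s + 2 * suc s →
  t + suc s + 2 * suc s ≤ 3 * ((t + suc s + 2) / 3 + k) + 1 →
  IsSb (t + suc s) k (suc s)
Sb-block t s k 1≤k lower upper = (block t (suc s) , raises , ∣block∣ t (suc s)) , minimal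
  where
  n = t + suc s
  Q = (n + 2) / 3

  γC : IsDominationNumber (Cycle n) Q
  γC = γ-cycle (≤-trans (s≤s z≤n) (m≤n+m (suc s) t))

  raises : Raises n k (block t (suc s))
  raises = Q , γC , subst (IsDominationNumber _) γ≡Q+k (γ-block t s)
    where
    γ≡Q+k : (n + 2 * suc s) / 3 ≡ Q + k
    γ≡Q+k = x/3≡a lower (≤-trans upper (+-monoʳ-≤ _ (n≤1+n 1)))

  minimal : (E : Subset n) → Raises n k E → suc s ≤ ∣ E ∣
  minimal E (m , γm , γE) with nonempty? E
  ... | no empty =
    ⊥-elim (<-irrefl (domination-number-unique γm γE′) (m<m+n m 1≤k))
    where
    γE′ : IsDominationNumber (Cycle n) (m + k)
    γE′ = subst (λ E → IsDominationNumber (CycleMinus n E) (m + k)) (Empty-unique empty) γE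
  ... | yes nonempty with upper-bound E nonempty
  ...   | D , dom , bound = 2*a≤2*b+1⇒a≤b (+-cancelˡ-≤ n _ _ (begin
    n + 2 * suc s        ≤⟨ upper ⟩
    3 * (Q + k) + 1      ≤⟨ +-monoˡ-≤ 1 (*-monoʳ-≤ 3 Q+k≤∣D∣) ⟩
    3 * ∣ D ∣ + 1         ≤⟨ +-monoˡ-≤ 1 bound ⟩
    n + 2 * ∣ E ∣ + 1     ≡⟨ +-assoc n _ 1 ⟩
    n + (2 * ∣ E ∣ + 1)   ∎))
    where
    open ≤-Reasoning
    Q+k≤∣D∣ : Q + k ≤ ∣ D ∣
    Q+k≤∣D∣ = subst (λ m → m + k ≤ ∣ D ∣) (domination-number-unique γm γC) (proj₂ γE D dom)

Sb-from-bounds : ∀ n k s → 1 ≤ k → 1 ≤ s → k + (n + 2) / 3 ≤ n →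
  3 * ((n + 2) / 3 + k) ≤ n + 2 * s → n + 2 * s ≤ 3 * ((n + 2) / 3 + k) + 1 → IsSb n k s
Sb-from-bounds n k (suc s) 1≤k _ k+Q≤n lower upper with m≤n⇒∃[o]m+o≡n s≤n
  where
  s≤n : suc s ≤ n
  s≤n = 2*a≤2*b+1⇒a≤b (+-cancelˡ-≤ n _ _ (begin
    n + 2 * suc s                  ≤⟨ upper ⟩
    3 * ((n + 2) / 3 + k) + 1      ≤⟨ +-monoˡ-≤ 1 (*-monoʳ-≤ 3 (≤-trans (≤-reflexive (+-comm _ k)) k+Q≤n)) ⟩
    3 * n + 1                      ≡⟨ 3n+1≡n+[2n+1] n ⟩
    n + (2 * n + 1)                ∎))
    where
    open ≤-Reasoning
    3n+1≡n+[2n+1] : ∀ n → 3 * n + 1 ≡ n + (2 * n + 1)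
    3n+1≡n+[2n+1] = solve-∀
... | t , s+t≡n with trans (+-comm t (suc s)) s+t≡n
...   | refl = Sb-block t s k 1≤k lower upper

-- m / 2 + 1 is the least s with 3 (⌈n/3⌉ + k) ≤ n + 2 s.
Sb-residue : ∀ n k m → 1 ≤ k → k + (n + 2) / 3 ≤ n → m + (n + 2) % 3 ≡ 3 * k + 1 →
  IsSb n k (m / 2 + 1)
Sb-residue n k m 1≤k k+Q≤n m+r≡3k+1 =
  Sb-from-bounds n k (m / 2 + 1) 1≤k (m≤n+m 1 (m / 2)) k+Q≤n
    (+-cancelʳ-≤ 1 _ _ (≤-trans (≤-reflexive (sym key)) (+-monoʳ-≤ _ (≤-pred (m%n<n m 2)))))
    (≤-trans (m≤m+n _ (m % 2)) (≤-reflexive key))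
  where
  Q = (n + 2) / 3
  key : n + 2 * (m / 2 + 1) + m % 2 ≡ 3 * (Q + k) + 1
  key = begin
    n + 2 * (m / 2 + 1) + m % 2           ≡⟨ regroup n (m / 2) (m % 2) ⟩
    (n + 2) + (m % 2 + m / 2 * 2)         ≡⟨ cong₂ _+_ (m≡m%n+[m/n]*n (n + 2) 3) (sym (m≡m%n+[m/n]*n m 2)) ⟩
    ((n + 2) % 3 + Q * 3) + m             ≡⟨ swap ((n + 2) % 3) Q m ⟩
    Q * 3 + (m + (n + 2) % 3)             ≡⟨ cong (Q * 3 +_) m+r≡3k+1 ⟩
    Q * 3 + (3 * k + 1)                   ≡⟨ collect Q k ⟩
    3 * (Q + k) + 1                       ∎
    where
    open ≡-Reasoning
    regroup : ∀ n h e → n + 2 * (h + 1) + e ≡ (n + 2) + (e + h * 2)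
    regroup = solve-∀
    swap : ∀ r q m → (r + q * 3) + m ≡ q * 3 + (m + r)
    swap = solve-∀
    collect : ∀ q k → q * 3 + (3 * k + 1) ≡ 3 * (q + k) + 1
    collect = solve-∀

theorem8 : (n k : ℕ) → 3 ≤ n → 1 ≤ k → k + (n + 2) / 3 ≤ n →
    (n % 3 ≡ 1 → IsSb n k ((3 * k + 1) / 2 + 1)) ×
    (n % 3 ≡ 2 → IsSb n k ((3 * k ∸ 1 + 1) / 2 + 1)) ×
    (n % 3 ≡ 0 → IsSb n k ((3 * k ∸ 1) / 2 + 1))
theorem8 n k _ 1≤k k+Q≤n =
    (λ n%3≡1 → Sb-residue n k _ 1≤k k+Q≤n
      (trans (cong (3 * k + 1 +_) ([n+2]%3 n%3≡1)) (+-identityʳ _)))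
  , (λ n%3≡2 → Sb-residue n k _ 1≤k k+Q≤n
      (trans (cong (3 * k ∸ 1 + 1 +_) ([n+2]%3 n%3≡2)) (cong (_+ 1) 3k∸1+1≡3k)))
  , (λ n%3≡0 → Sb-residue n k _ 1≤k k+Q≤n
      (trans (cong (3 * k ∸ 1 +_) ([n+2]%3 n%3≡0)) (trans (sym (+-assoc _ 1 1)) (cong (_+ 1) 3k∸1+1≡3k))))
  where
  [n+2]%3 : ∀ {r} → n % 3 ≡ r → (n + 2) % 3 ≡ (r + 2) % 3
  [n+2]%3 n%3≡r = trans (%-distribˡ-+ n 2 3) (cong (λ r → (r + 2) % 3) n%3≡r)
  3k∸1+1≡3k : 3 * k ∸ 1 + 1 ≡ 3 * k
  3k∸1+1≡3k = m∸n+n≡m (≤-trans 1≤k (m≤n*m k 3))
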